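{- Let $(V,w)$ be a finite metric space and $T=\{(s_1,t_1),\dots,(s_k,t_k)\}$ a set of terminal pairs, and let $\mathrm{OPT}$ be the minimum total weight $\sum_{(x,y)\in F}w(x,y)$ over edge sets $F\subseteq V\times V$ such that $s_j$ and $t_j$ are connected in $(V,F)$ for all $j$. For every integer $0\le i\le L$, if $M_i$ is the size of any maximal independent set in the ball graph $H_i$, then $\mathrm{OPT}\ge M_i\cdot \tau_i$.
   Context: The terminal pairs are assumed pairwise disjoint (each terminal belongs to exactly one pair). For a terminal $s$ its match $m(s)$ is the other vertex of its pair. $\tau_i=2^i$ and $L=\log_2(2k^2)$ (rounded to an integer). A terminal $s$ is active at level $i$ if $w(s,m(s))\ge\tau_i$. The ball graph $H_i$ is the unweighted graph whose vertex set $V_i^H$ is the set of terminals active at level $i$, with $u,v\in V_i^H$ adjacent iff $w(u,v)<2\tau_i$.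
   Formalization: The distances $w$ of the finite metric space take rational values. -}

module Defs where

open import Data.Nat as ℕ using (ℕ; zero; suc; _^_)
open import Data.Nat.Logarithm using (⌈log₂_⌉)
open import Data.Integer using (+_)
open import Data.Rational as ℚ using (ℚ; _≤_; _<_; _+_; 0ℚ)
open import Data.Fin using (Fin; zero; suc)
open import Data.Fin.Subset using (Subset; _∈_; _⊆_)
open import Data.Bool using (Bool; true; false)
open import Data.Product using (_×_; ∃; ∃-syntax; Σ)
open import Data.Sum using (_⊎_)
open import Relation.Binary.PropositionalEquality using (_≡_; _≢_)
open import Relation.Nullary using (¬_)

ℕ→ℚ : ℕ → ℚ
ℕ→ℚ m = (+ m) ℚ./ 1

record IsMetric {n : ℕ} (w : Fin n → Fin n → ℚ) : Set where
  field
    w-self  : ∀ x → w x x ≡ 0ℚ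
    w-pos   : ∀ x y → x ≢ y → 0ℚ < w x y
    w-sym   : ∀ x y → w x y ≡ w y x
    w-tri   : ∀ x y z → w x z ≤ w x y + w y z

record DisjointPairs {n k : ℕ} (s t : Fin k → Fin n) : Set where
  field
    s-inj : ∀ j j' → s j ≡ s j' → j ≡ j'
    t-inj : ∀ j j' → t j ≡ t j' → j ≡ j'
    s≢t   : ∀ j j' → s j ≢ t j'

sumFin : ∀ {n} → (Fin n → ℚ) → ℚ
sumFin {zero}  f = 0ℚ
sumFin {suc n} f = f zero + sumFin (λ x → f (suc x))

EdgeSet : ℕ → Set
EdgeSet n = Fin n → Fin n → Bool

cost : ∀ {n} → (Fin n → Fin n → ℚ) → EdgeSet n → ℚ
cost w F = sumFin (λ x → sumFin (λ y → weightIf (F x y) (w x y)))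
  where
  weightIf : Bool → ℚ → ℚ
  weightIf true  q = q
  weightIf false q = 0ℚ

data Connected {n : ℕ} (F : EdgeSet n) : Fin n → Fin n → Set where
  here : ∀ {x} → Connected F x x
  step : ∀ {x y z} → (F x y ≡ true ⊎ F y x ≡ true) → Connected F y z → Connected F x z

Feasible : ∀ {n k} → (s t : Fin k → Fin n) → EdgeSet n → Set
Feasible s t F = ∀ j → Connected F (s j) (t j)

IsOPT : ∀ {n k} → (Fin n → Fin n → ℚ) → (s t : Fin k → Fin n) → ℚ → Set
IsOPT w s t opt =
  (∃[ F ] (Feasible s t F × cost w F ≡ opt)) ×
  (∀ F → Feasible s t F → opt ≤ cost w F)

τ : ℕ → ℕ
τ i = 2 ^ i

Lk : ℕ → ℕ
Lk k = ⌈log₂ (2 ℕ.* k ℕ.* k) ⌉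

Active : ∀ {n k} → (Fin n → Fin n → ℚ) → (s t : Fin k → Fin n) → ℕ → Fin n → Set
Active w s t i v =
  ∃[ j ] (((v ≡ s j) ⊎ (v ≡ t j)) × (ℕ→ℚ (τ i) ≤ w (s j) (t j)))

Adj : ∀ {n} → (Fin n → Fin n → ℚ) → ℕ → Fin n → Fin n → Set
Adj w i u v = u ≢ v × w u v < ℕ→ℚ (2 ℕ.* τ i)

IndependentH : ∀ {n k} → (Fin n → Fin n → ℚ) → (s t : Fin k → Fin n) → ℕ → Subset n → Set
IndependentH w s t i I =
  (∀ v → v ∈ I → Active w s t i v) ×
  (∀ u v → u ∈ I → v ∈ I → ¬ Adj w i u v)

MaximalIndependentH : ∀ {n k} → (Fin n → Fin n → ℚ) → (s t : Fin k → Fin n) → ℕ → Subset n → Set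
MaximalIndependentH w s t i I =
  IndependentH w s t i I ×
  (∀ J → IndependentH w s t i J → I ⊆ J → J ⊆ I)

-- For a centre u of I put bump u z = max (τ − w(u,z), 0).  Centres of an independent set are
-- 2τ apart, so their open τ-balls are disjoint, and for every pair x, y the total variation
-- Σ_u |bump u x − bump u y| is at most w(x,y).  Each centre u is a terminal whose mate m has
-- w(u,m) ≥ τ and is connected to u in an optimal F, so along that walk bump u falls from τ to 0:
-- the variation of bump u over the edges of F is at least τ.  Summing over u and exchanging
-- the sums gives |I|·τ ≤ cost F = OPT.
-- A walk may use an edge several times, so the bound "rise of h along a walk ≤ variation of h"
-- is proved by induction on the edge list: a walk through the edge pq is cut at its first and
-- last traversal of pq, and the two outer pieces are charged to truncations of h that live in
-- disjoint value ranges.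
module Submission where

open import Defs
open import Data.Bool using (Bool; true; false; if_then_else_)
open import Data.Bool.Properties using (T-≡)
open import Data.Fin using (Fin; zero; suc)
open import Data.Fin.Properties using (suc-injective) renaming (_≟_ to _≟ᶠ_)
open import Data.Fin.Subset using (Subset; inside; outside) renaming (_∈_ to _∈ₛ_; ∣_∣ to ∣_∣ₛ)
import Data.Integer as ℤ
import Data.Integer.Properties as ℤₚ
open import Data.List using (List; []; _∷_; _++_; map; length; tabulate; allFin; cartesianProduct; filterᵇ)
open import Data.List.Membership.Propositional using (_∈_)
open import Data.List.Membership.Propositional.Properties using (∈-allFin; ∈-cartesianProduct⁺; ∈-filter⁺)
open import Data.List.Relation.Unary.All as All using (All; []; _∷_)
import Data.List.Relation.Unary.All.Properties as All
open import Data.List.Relation.Unary.AllPairs using (AllPairs; []; _∷_)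
import Data.List.Relation.Unary.AllPairs.Properties as AllPairs
open import Data.List.Properties using (length-map)
open import Data.List.Relation.Unary.Any using (here; there)
open import Data.Nat as ℕ using (ℕ; _*_)
import Data.Nat.Properties as ℕₚ
open import Data.Nat.Coprimality using (1-coprimeTo)
import Data.Nat.Coprimality as Coprime
open import Data.Product using (_×_; _,_; proj₁; proj₂; ∃-syntax; uncurry)
open import Data.Rational as ℚ using (ℚ; mkℚ; 0ℚ; _+_; _-_; -_; _≤_; _<_; _⊓_; _⊔_; ∣_∣)
open import Data.Rational.Properties
open import Data.Rational.Solver using (module +-*-Solver)
open import Data.Sum using (_⊎_; inj₁; inj₂; swap)
open import Data.Vec using ([]; _∷_; here; there)
open import Function using (_∘_; Equivalence)
open import Relation.Binary.Construct.Closure.ReflexiveTransitive using (Star; ε; _◅_; reverse)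
open import Relation.Binary.PropositionalEquality
open import Relation.Nullary using (¬_; yes; no)

open +-*-Solver using (solve; _:+_; _:-_; :-_; _:=_)

private
  variable
    n : ℕ
    A B : Set
    p q p′ q′ r c d u v : ℚ

p≤q⇒0≤q-p : p ≤ q → 0ℚ ≤ q - p
p≤q⇒0≤q-p {p} {q} p≤q = begin
  0ℚ    ≡⟨ +-inverseʳ p ⟨
  p - p ≤⟨ +-monoˡ-≤ (- p) p≤q ⟩
  q - p ∎
  where open ≤-Reasoning

p≤q+r⇒p-q≤r : p ≤ q + r → p - q ≤ r
p≤q+r⇒p-q≤r {p} {q} {r} p≤q+r = begin
  p - q       ≤⟨ +-monoˡ-≤ (- q) p≤q+r ⟩
  q + r - q   ≡⟨ solve 2 (λ q r → q :+ r :- q := r) refl q r ⟩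
  r           ∎
  where open ≤-Reasoning

0≤p⇒q≤p+q : 0ℚ ≤ p → q ≤ p + q
0≤p⇒q≤p+q {p} {q} 0≤p = ≤-trans (≤-reflexive (sym (+-identityˡ q))) (+-monoˡ-≤ q 0≤p)

p-q≤p′-q′ : p ≤ p′ → q′ ≤ q → p - q ≤ p′ - q′
p-q≤p′-q′ p≤p′ q′≤q = +-mono-≤ p≤p′ (neg-antimono-≤ q′≤q)

∣p-q∣≡∣q-p∣ : ∀ p q → ∣ p - q ∣ ≡ ∣ q - p ∣
∣p-q∣≡∣q-p∣ p q = begin
  ∣ p - q ∣       ≡⟨ cong ∣_∣ (solve 2 (λ p q → p :- q := :- (q :- p)) refl p q) ⟩
  ∣ - (q - p) ∣   ≡⟨ ∣-p∣≡∣p∣ (q - p) ⟩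
  ∣ q - p ∣       ∎
  where open ≡-Reasoning

q≤p⇒∣p-q∣≡p-q : q ≤ p → ∣ p - q ∣ ≡ p - q
q≤p⇒∣p-q∣≡p-q q≤p = 0≤p⇒∣p∣≡p (p≤q⇒0≤q-p q≤p)

∣p-q∣≤r : p - q ≤ r → q - p ≤ r → ∣ p - q ∣ ≤ r
∣p-q∣≤r {p} {q} {r} p-q≤r q-p≤r with ∣p∣≡p∨∣p∣≡-p (p - q)
... | inj₁ ∣p-q∣≡p-q  = subst (_≤ r) (sym ∣p-q∣≡p-q) p-q≤r
... | inj₂ ∣p-q∣≡q-p = subst (_≤ r) (sym (trans ∣p-q∣≡q-p (solve 2 (λ p q → :- (p :- q) := q :- p) refl p q))) q-p≤r

p⊔q-p⊓q≡∣p-q∣ : ∀ p q → (p ⊔ q) - p ⊓ q ≡ ∣ p - q ∣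
p⊔q-p⊓q≡∣p-q∣ p q with ≤-total p q
... | inj₁ p≤q rewrite p≤q⇒p⊔q≡q p≤q | p≤q⇒p⊓q≡p p≤q = sym (trans (∣p-q∣≡∣q-p∣ p q) (q≤p⇒∣p-q∣≡p-q p≤q))
... | inj₂ q≤p rewrite p≥q⇒p⊔q≡p q≤p | p≥q⇒p⊓q≡q q≤p = sym (q≤p⇒∣p-q∣≡p-q q≤p)

-- For c ≤ d the increments of u ⊓ c and u ⊔ d come from the disjoint ranges below c and above d.
⊓-⊔-increments : c ≤ d → u ≤ v → ∣ v ⊓ c - u ⊓ c ∣ + ∣ (v ⊔ d) - (u ⊔ d) ∣ ≤ ∣ v - u ∣
⊓-⊔-increments {c} {d} {u} {v} c≤d u≤v
  rewrite q≤p⇒∣p-q∣≡p-q (⊓-monoˡ-≤ c u≤v) | q≤p⇒∣p-q∣≡p-q (⊔-monoˡ-≤ d u≤v) | q≤p⇒∣p-q∣≡p-q u≤v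
  with ≤-total u c | ≤-total v d
... | inj₁ u≤c | inj₁ v≤d
  rewrite p≤q⇒p⊔q≡q (≤-trans u≤c c≤d) | p≤q⇒p⊓q≡p u≤c | p≤q⇒p⊔q≡q v≤d = begin
    (v ⊓ c - u) + (d - d) ≡⟨ solve 3 (λ m u d → (m :- u) :+ (d :- d) := m :- u) refl (v ⊓ c) u d ⟩
    v ⊓ c - u             ≤⟨ +-monoˡ-≤ (- u) (p⊓q≤p v c) ⟩
    v - u                 ∎
  where open ≤-Reasoning
... | inj₁ u≤c | inj₂ d≤v
  rewrite p≤q⇒p⊓q≡p u≤c | p≥q⇒p⊓q≡q (≤-trans c≤d d≤v) | p≥q⇒p⊔q≡p d≤v | p≤q⇒p⊔q≡q (≤-trans u≤c c≤d) = begin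
    (c - u) + (v - d) ≤⟨ +-monoˡ-≤ (v - d) (+-monoˡ-≤ (- u) c≤d) ⟩
    (d - u) + (v - d) ≡⟨ solve 3 (λ d u v → (d :- u) :+ (v :- d) := v :- u) refl d u v ⟩
    v - u             ∎
  where open ≤-Reasoning
... | inj₂ c≤u | inj₁ v≤d
  rewrite p≥q⇒p⊓q≡q c≤u | p≥q⇒p⊓q≡q (≤-trans c≤u u≤v) | p≤q⇒p⊔q≡q v≤d | p≤q⇒p⊔q≡q (≤-trans u≤v v≤d) = begin
    (c - c) + (d - d) ≡⟨ solve 2 (λ c d → (c :- c) :+ (d :- d) := c :- c) refl c d ⟩
    c - c             ≡⟨ +-inverseʳ c ⟩
    0ℚ                ≤⟨ p≤q⇒0≤q-p u≤v ⟩
    v - u             ∎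
  where open ≤-Reasoning
... | inj₂ c≤u | inj₂ d≤v
  rewrite p≥q⇒p⊓q≡q c≤u | p≥q⇒p⊓q≡q (≤-trans c≤u u≤v) | p≥q⇒p⊔q≡p d≤v = begin
    (c - c) + (v - (u ⊔ d)) ≡⟨ solve 3 (λ c v m → (c :- c) :+ (v :- m) := v :- m) refl c v (u ⊔ d) ⟩
    v - (u ⊔ d)             ≤⟨ +-monoʳ-≤ v (neg-antimono-≤ (p≤p⊔q u d)) ⟩
    v - u                   ∎
  where open ≤-Reasoning

∣⊓∣+∣⊔∣≤∣-∣ : c ≤ d → ∀ u v → ∣ u ⊓ c - v ⊓ c ∣ + ∣ (u ⊔ d) - (v ⊔ d) ∣ ≤ ∣ u - v ∣
∣⊓∣+∣⊔∣≤∣-∣ {c} {d} c≤d u v with ≤-total v u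
... | inj₁ v≤u = ⊓-⊔-increments c≤d v≤u
... | inj₂ u≤v = subst₂ _≤_
  (cong₂ _+_ (∣p-q∣≡∣q-p∣ (v ⊓ c) (u ⊓ c)) (∣p-q∣≡∣q-p∣ (v ⊔ d) (u ⊔ d)))
  (∣p-q∣≡∣q-p∣ v u)
  (⊓-⊔-increments c≤d u≤v)

∣⊔∣≤∣-∣ : ∀ c u v → ∣ (u ⊔ c) - (v ⊔ c) ∣ ≤ ∣ u - v ∣
∣⊔∣≤∣-∣ c u v = ≤-trans (0≤p⇒q≤p+q (0≤∣p∣ (u ⊓ c - v ⊓ c))) (∣⊓∣+∣⊔∣≤∣-∣ ≤-refl u v)

sumOver : List A → (A → ℚ) → ℚ
sumOver []       f = 0ℚ
sumOver (x ∷ xs) f = f x + sumOver xs f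

syntax sumOver xs (λ x → e) = ∑[ x ∈ xs ] e

∑-cong : ∀ (xs : List A) {f g : A → ℚ} → (∀ x → f x ≡ g x) → sumOver xs f ≡ sumOver xs g
∑-cong []       f≗g = refl
∑-cong (x ∷ xs) f≗g = cong₂ _+_ (f≗g x) (∑-cong xs f≗g)

∑-mono-≤ : ∀ (xs : List A) {f g : A → ℚ} → All (λ x → f x ≤ g x) xs → sumOver xs f ≤ sumOver xs g
∑-mono-≤ []       []            = ≤-refl
∑-mono-≤ (x ∷ xs) (fx≤gx ∷ f≤g) = +-mono-≤ fx≤gx (∑-mono-≤ xs f≤g)

∑-zero : ∀ (xs : List A) → ∑[ x ∈ xs ] 0ℚ ≡ 0ℚ
∑-zero []       = refl
∑-zero (x ∷ xs) = trans (+-identityˡ _) (∑-zero xs)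

∑-distrib-+ : ∀ (xs : List A) (f g : A → ℚ) → ∑[ x ∈ xs ] (f x + g x) ≡ sumOver xs f + sumOver xs g
∑-distrib-+ []       f g = sym (+-identityˡ 0ℚ)
∑-distrib-+ (x ∷ xs) f g = begin
  (f x + g x) + ∑[ y ∈ xs ] (f y + g y)       ≡⟨ cong ((f x + g x) +_) (∑-distrib-+ xs f g) ⟩
  (f x + g x) + (sumOver xs f + sumOver xs g) ≡⟨ interchange (f x) (g x) (sumOver xs f) (sumOver xs g) ⟩
  (f x + sumOver xs f) + (g x + sumOver xs g) ∎
  where
  open ≡-Reasoning
  interchange : ∀ a b c d → (a + b) + (c + d) ≡ (a + c) + (b + d)
  interchange = solve 4 (λ a b c d → (a :+ b) :+ (c :+ d) := (a :+ c) :+ (b :+ d)) refl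

∑-comm : ∀ (xs : List A) (ys : List B) (g : A → B → ℚ) →
         ∑[ x ∈ xs ] ∑[ y ∈ ys ] g x y ≡ ∑[ y ∈ ys ] ∑[ x ∈ xs ] g x y
∑-comm []       ys g = sym (∑-zero ys)
∑-comm (x ∷ xs) ys g = trans (cong (sumOver ys (g x) +_) (∑-comm xs ys g))
                             (sym (∑-distrib-+ ys (g x) (λ y → ∑[ x ∈ xs ] g x y)))

∑-++ : ∀ (xs ys : List A) (f : A → ℚ) → sumOver (xs ++ ys) f ≡ sumOver xs f + sumOver ys f
∑-++ []       ys f = sym (+-identityˡ _)
∑-++ (x ∷ xs) ys f = trans (cong (f x +_) (∑-++ xs ys f)) (sym (+-assoc (f x) _ _))

∑-map : ∀ (g : A → B) (xs : List A) (f : B → ℚ) → sumOver (map g xs) f ≡ ∑[ x ∈ xs ] f (g x)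
∑-map g []       f = refl
∑-map g (x ∷ xs) f = cong (f (g x) +_) (∑-map g xs f)

∑-tabulate : ∀ {n} (g : Fin n → A) (f : A → ℚ) → sumOver (tabulate g) f ≡ sumFin (f ∘ g)
∑-tabulate {n = ℕ.zero}  g f = refl
∑-tabulate {n = ℕ.suc n} g f = cong (f (g zero) +_) (∑-tabulate (g ∘ suc) f)

∑-cartesianProduct : ∀ (xs : List A) (ys : List B) (f : A × B → ℚ) →
                     sumOver (cartesianProduct xs ys) f ≡ ∑[ x ∈ xs ] ∑[ y ∈ ys ] f (x , y)
∑-cartesianProduct []       ys f = refl
∑-cartesianProduct (x ∷ xs) ys f = begin
  sumOver (map (x ,_) ys ++ cartesianProduct xs ys) f            ≡⟨ ∑-++ (map (x ,_) ys) _ f ⟩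
  sumOver (map (x ,_) ys) f + sumOver (cartesianProduct xs ys) f ≡⟨ cong₂ _+_ (∑-map (x ,_) ys f) (∑-cartesianProduct xs ys f) ⟩
  (∑[ y ∈ ys ] f (x , y)) + (∑[ x ∈ xs ] ∑[ y ∈ ys ] f (x , y))  ∎
  where open ≡-Reasoning

∑-filterᵇ : ∀ (b : A → Bool) (xs : List A) (f : A → ℚ) →
            sumOver (filterᵇ b xs) f ≡ ∑[ x ∈ xs ] (if b x then f x else 0ℚ)
∑-filterᵇ b []       f = refl
∑-filterᵇ b (x ∷ xs) f with b x
... | true  = cong (f x +_) (∑-filterᵇ b xs f)
... | false = trans (∑-filterᵇ b xs f) (sym (+-identityˡ _))

-- Walks and variation

Edge : ℕ → Set
Edge n = Fin n × Fin n

Link : List (Edge n) → Fin n → Fin n → Set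
Link E x y = (x , y) ∈ E ⊎ (y , x) ∈ E

Walk : List (Edge n) → Fin n → Fin n → Set
Walk E = Star (Link E)

variation : (Fin n → ℚ) → List (Edge n) → ℚ
variation h E = ∑[ e ∈ E ] ∣ h (proj₁ e) - h (proj₂ e) ∣

data WalkThrough (E : List (Edge n)) (p q : Fin n) (a b : Fin n) : Set where
  avoiding : Walk E a b → WalkThrough E p q a b
  via-pq   : Walk E a p → Walk E q b → WalkThrough E p q a b
  via-qp   : Walk E a q → Walk E p b → WalkThrough E p q a b

walkThrough : ∀ {E : List (Edge n)} {p q a b} → Walk ((p , q) ∷ E) a b → WalkThrough E p q a b
walkThrough ε             = avoiding ε
walkThrough (link ◅ walk) = prepend link (walkThrough walk)
  where
  prepend-link : ∀ {E : List (Edge n)} {p q x y b} → Link E x y → WalkThrough E p q y b → WalkThrough E p q x b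
  prepend-link l (avoiding w)   = avoiding (l ◅ w)
  prepend-link l (via-pq w₁ w₂) = via-pq (l ◅ w₁) w₂
  prepend-link l (via-qp w₁ w₂) = via-qp (l ◅ w₁) w₂

  prepend : ∀ {E : List (Edge n)} {p q x y b} → Link ((p , q) ∷ E) x y → WalkThrough E p q y b → WalkThrough E p q x b
  prepend (inj₁ (here refl)) (avoiding w) = via-pq ε w
  prepend (inj₁ (here refl)) (via-pq _ w) = via-pq ε w
  prepend (inj₁ (here refl)) (via-qp _ w) = avoiding w
  prepend (inj₂ (here refl)) (avoiding w) = via-qp ε w
  prepend (inj₂ (here refl)) (via-pq _ w) = avoiding w
  prepend (inj₂ (here refl)) (via-qp _ w) = via-qp ε w
  prepend (inj₁ (there e))   s            = prepend-link (inj₁ e) s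
  prepend (inj₂ (there e))   s            = prepend-link (inj₂ e) s

variation-⊓-⊔ : ∀ (E : List (Edge n)) (h : Fin n → ℚ) → c ≤ d →
                variation (λ z → h z ⊓ c) E + variation (λ z → h z ⊔ d) E ≤ variation h E
variation-⊓-⊔ {c = c} {d} E h c≤d = begin
  variation (λ z → h z ⊓ c) E + variation (λ z → h z ⊔ d) E ≡⟨ ∑-distrib-+ E _ _ ⟨
  ∑[ e ∈ E ] (∣ h (proj₁ e) ⊓ c - h (proj₂ e) ⊓ c ∣ + ∣ (h (proj₁ e) ⊔ d) - (h (proj₂ e) ⊔ d) ∣)
    ≤⟨ ∑-mono-≤ E (All.universal (λ e → ∣⊓∣+∣⊔∣≤∣-∣ c≤d (h (proj₁ e)) (h (proj₂ e))) E) ⟩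
  variation h E ∎
  where open ≤-Reasoning

rise≤variation : ∀ (E : List (Edge n)) (h : Fin n → ℚ) {a b} → Walk E a b → h b - h a ≤ variation h E

-- With lo = min (h p) (h q) and hi = max (h p) (h q), the rise of h splits into the rise of h ⊓ lo
-- along a ⇝ p, the jump hi − lo across pq, and the rise of h ⊔ hi along q ⇝ b.
rise≤jump+variation : ∀ (E : List (Edge n)) (h : Fin n → ℚ) {a b p q} → Walk E a p → Walk E q b →
                      h b - h a ≤ ∣ h p - h q ∣ + variation h E
rise≤jump+variation E h {a} {b} {p} {q} a⇝p q⇝b = begin
  h b - h a                                          ≤⟨ p-q≤p′-q′ (p≤p⊔q (h b) hi) (p⊓q≤p (h a) lo) ⟩
  (h b ⊔ hi) - h a ⊓ lo                              ≡⟨ telescope (h b ⊔ hi) hi lo (h a ⊓ lo) ⟩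
  ((h b ⊔ hi) - hi) + ((hi - lo) + (lo - h a ⊓ lo))  ≤⟨ +-mono-≤ rise-above (+-monoʳ-≤ (hi - lo) rise-below) ⟩
  V⊔ + ((hi - lo) + V⊓)                              ≡⟨ solve 3 (λ x j y → x :+ (j :+ y) := j :+ (y :+ x)) refl V⊔ (hi - lo) V⊓ ⟩
  (hi - lo) + (V⊓ + V⊔)                              ≤⟨ +-mono-≤ (≤-reflexive (p⊔q-p⊓q≡∣p-q∣ (h p) (h q))) (variation-⊓-⊔ E h lo≤hi) ⟩
  ∣ h p - h q ∣ + variation h E                      ∎
  where
  open ≤-Reasoning
  lo hi V⊓ V⊔ : ℚ
  lo = h p ⊓ h q
  hi = h p ⊔ h q
  V⊓ = variation (λ z → h z ⊓ lo) E
  V⊔ = variation (λ z → h z ⊔ hi) E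
  lo≤hi : lo ≤ hi
  lo≤hi = ≤-trans (p⊓q≤p (h p) (h q)) (p≤p⊔q (h p) (h q))
  telescope : ∀ x y z t → x - t ≡ (x - y) + ((y - z) + (z - t))
  telescope = solve 4 (λ x y z t → x :- t := (x :- y) :+ ((y :- z) :+ (z :- t))) refl
  rise-below : lo - h a ⊓ lo ≤ V⊓
  rise-below = ≤-trans (+-monoˡ-≤ (- (h a ⊓ lo)) (⊓-glb (p⊓q≤p (h p) (h q)) ≤-refl))
                       (rise≤variation E (λ z → h z ⊓ lo) a⇝p)
  rise-above : (h b ⊔ hi) - hi ≤ V⊔
  rise-above = ≤-trans (+-monoʳ-≤ (h b ⊔ hi) (neg-antimono-≤ (⊔-lub (p≤q⊔p (h p) (h q)) ≤-refl)))
                       (rise≤variation E (λ z → h z ⊔ hi) q⇝b)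

rise≤variation []            h ε                = ≤-reflexive (+-inverseʳ (h _))
rise≤variation []            h (inj₁ () ◅ _)
rise≤variation []            h (inj₂ () ◅ _)
rise≤variation ((p , q) ∷ E) h walk with walkThrough walk
... | avoiding a⇝b    = ≤-trans (rise≤variation E h a⇝b) (0≤p⇒q≤p+q (0≤∣p∣ (h p - h q)))
... | via-pq a⇝p q⇝b = rise≤jump+variation E h a⇝p q⇝b
... | via-qp a⇝q p⇝b = subst (λ j → _ ≤ j + variation h E) (∣p-q∣≡∣q-p∣ (h q) (h p))
                              (rise≤jump+variation E h a⇝q p⇝b)

-- Packing disjoint balls in a finite metric space

module Packing {w : Fin n → Fin n → ℚ} (metric : IsMetric w) (r : ℚ) where
  open IsMetric metric

  bump : Fin n → Fin n → ℚ
  bump u z = (r - w u z) ⊔ 0ℚ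

  Separated : Fin n → Fin n → Set
  Separated u v = r + r ≤ w u v

  charge : List (Fin n) → Fin n → Fin n → ℚ
  charge L x y = ∑[ u ∈ L ] ∣ bump u x - bump u y ∣

  bump-outside : ∀ {u z} → r ≤ w u z → bump u z ≡ 0ℚ
  bump-outside {u} {z} r≤w = p≤q⇒p⊔q≡q (≤-trans (+-monoˡ-≤ (- w u z) r≤w) (≤-reflexive (+-inverseʳ (w u z))))

  bump-inside : ∀ {u z} → w u z < r → bump u z ≡ r - w u z
  bump-inside w<r = p≥q⇒p⊔q≡p (p≤q⇒0≤q-p (<⇒≤ w<r))

  bump-centre : 0ℚ ≤ r → ∀ u → bump u u ≡ r
  bump-centre 0≤r u rewrite w-self u = trans (cong (_⊔ 0ℚ) (+-identityʳ r)) (p≥q⇒p⊔q≡p 0≤r)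

  bump-lipschitz : ∀ u x y → ∣ bump u x - bump u y ∣ ≤ w x y
  bump-lipschitz u x y = begin
    ∣ bump u x - bump u y ∣        ≤⟨ ∣⊔∣≤∣-∣ 0ℚ (r - w u x) (r - w u y) ⟩
    ∣ (r - w u x) - (r - w u y) ∣  ≡⟨ cong ∣_∣ (solve 3 (λ r a b → (r :- a) :- (r :- b) := b :- a) refl r (w u x) (w u y)) ⟩
    ∣ w u y - w u x ∣              ≤⟨ ∣p-q∣≤r {w u y} (p≤q+r⇒p-q≤r (w-tri u x y)) (p≤q+r⇒p-q≤r ux≤uy+xy) ⟩
    w x y                          ∎
    where
    open ≤-Reasoning
    ux≤uy+xy : w u x ≤ w u y + w x y
    ux≤uy+xy = subst (λ d → w u x ≤ w u y + d) (w-sym y x) (w-tri u y x)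

  separated-outside : ∀ {u v z} → Separated u v → w u z < r → r ≤ w v z
  separated-outside {u} {v} {z} sep uz<r = ≮⇒≥ λ vz<r → <-irrefl refl (begin-strict
    r + r           ≤⟨ sep ⟩
    w u v           ≤⟨ w-tri u z v ⟩
    w u z + w z v   ≡⟨ cong (w u z +_) (w-sym z v) ⟩
    w u z + w v z   <⟨ +-mono-< uz<r vz<r ⟩
    r + r           ∎)
    where open ≤-Reasoning

  separated-depths : ∀ {u v} x y → Separated u v → (r - w u x) + (r - w v y) ≤ w x y
  separated-depths {u} {v} x y sep = begin
    (r - w u x) + (r - w v y)                 ≡⟨ solve 3 (λ r a b → (r :- a) :+ (r :- b) := (r :+ r) :- (a :+ b)) refl r (w u x) (w v y) ⟩
    (r + r) - (w u x + w v y)                 ≤⟨ +-monoˡ-≤ (- (w u x + w v y)) path ⟩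
    (w u x + w x y + w v y) - (w u x + w v y) ≡⟨ solve 3 (λ a c b → (a :+ c :+ b) :- (a :+ b) := c) refl (w u x) (w x y) (w v y) ⟩
    w x y                                     ∎
    where
    open ≤-Reasoning
    path : r + r ≤ w u x + w x y + w v y
    path = begin
      r + r                   ≤⟨ sep ⟩
      w u v                   ≤⟨ w-tri u x v ⟩
      w u x + w x v           ≤⟨ +-monoʳ-≤ (w u x) (w-tri x y v) ⟩
      w u x + (w x y + w y v) ≡⟨ cong (λ d → w u x + (w x y + d)) (w-sym y v) ⟩
      w u x + (w x y + w v y) ≡⟨ +-assoc (w u x) (w x y) (w v y) ⟨
      w u x + w x y + w v y   ∎

  w≥0 : ∀ x y → 0ℚ ≤ w x y
  w≥0 x y with x ≟ᶠ y
  ... | yes refl = ≤-reflexive (sym (w-self x))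
  ... | no x≢y   = <⇒≤ (w-pos x y x≢y)

  charge-sym : ∀ L x y → charge L x y ≡ charge L y x
  charge-sym L x y = ∑-cong L (λ u → ∣p-q∣≡∣q-p∣ (bump u x) (bump u y))

  no-charge : ∀ {v x y} → r ≤ w v x → r ≤ w v y → ∣ bump v x - bump v y ∣ ≡ 0ℚ
  no-charge vx vy rewrite bump-outside vx | bump-outside vy = refl

  charge-outside : ∀ {L x y} → All (λ v → r ≤ w v x) L → All (λ v → r ≤ w v y) L → charge L x y ≡ 0ℚ
  charge-outside []        []        = refl
  charge-outside (vx ∷ Lx) (vy ∷ Ly) = trans (cong₂ _+_ (no-charge vx vy) (charge-outside Lx Ly)) (+-identityʳ 0ℚ)

  exit-charge : ∀ {u x y} → w u x < r → r ≤ w u y → ∣ bump u x - bump u y ∣ ≡ r - w u x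
  exit-charge {u} {x} ux<r r≤uy rewrite bump-inside ux<r | bump-outside r≤uy =
    trans (cong ∣_∣ (+-identityʳ (r - w u x))) (q≤p⇒∣p-q∣≡p-q (<⇒≤ ux<r))

  outside-separated : ∀ {u z L} → w u z < r → All (Separated u) L → All (λ v → r ≤ w v z) L
  outside-separated uz<r = All.map (λ sep → separated-outside sep uz<r)

  -- At most one further centre can have y in its ball.
  depth+charge≤w : ∀ {u x y} L → w u x < r → r ≤ w u y → All (Separated u) L → AllPairs Separated L →
                   (r - w u x) + charge L x y ≤ w x y
  depth+charge≤w {u} {x} {y} [] ux<r r≤uy [] [] = begin
    (r - w u x) + 0ℚ         ≡⟨ +-identityʳ _ ⟩
    r - w u x                ≡⟨ exit-charge ux<r r≤uy ⟨
    ∣ bump u x - bump u y ∣  ≤⟨ bump-lipschitz u x y ⟩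
    w x y                    ∎
    where open ≤-Reasoning
  depth+charge≤w {u} {x} {y} (v ∷ L) ux<r r≤uy (u∼v ∷ u∼L) (v∼L ∷ L∼L) with w v y <? r
  ... | yes vy<r = begin
    (r - w u x) + (∣ bump v x - bump v y ∣ + charge L x y)
      ≡⟨ cong (λ t → (r - w u x) + (t + charge L x y))
              (trans (∣p-q∣≡∣q-p∣ (bump v x) (bump v y)) (exit-charge vy<r (separated-outside u∼v ux<r))) ⟩
    (r - w u x) + ((r - w v y) + charge L x y)
      ≡⟨ cong (λ t → (r - w u x) + ((r - w v y) + t))
              (charge-outside (outside-separated ux<r u∼L) (outside-separated vy<r v∼L)) ⟩
    (r - w u x) + ((r - w v y) + 0ℚ)
      ≡⟨ cong ((r - w u x) +_) (+-identityʳ _) ⟩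
    (r - w u x) + (r - w v y)
      ≤⟨ separated-depths x y u∼v ⟩
    w x y ∎
    where open ≤-Reasoning
  ... | no vy≮r = begin
    (r - w u x) + (∣ bump v x - bump v y ∣ + charge L x y)
      ≡⟨ cong (λ t → (r - w u x) + (t + charge L x y)) (no-charge (separated-outside u∼v ux<r) (≮⇒≥ vy≮r)) ⟩
    (r - w u x) + (0ℚ + charge L x y)
      ≡⟨ cong ((r - w u x) +_) (+-identityˡ _) ⟩
    (r - w u x) + charge L x y
      ≤⟨ depth+charge≤w L ux<r r≤uy u∼L L∼L ⟩
    w x y ∎
    where open ≤-Reasoning

  charge≤distance : ∀ {L} → AllPairs Separated L → ∀ x y → charge L x y ≤ w x y
  charge≤distance []          x y = w≥0 x y
  charge≤distance {u ∷ L} (u∼L ∷ L∼L) x y with w u x <? r | w u y <? r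
  ... | yes ux<r | yes uy<r = begin
    ∣ bump u x - bump u y ∣ + charge L x y ≡⟨ cong (∣ bump u x - bump u y ∣ +_) (charge-outside (outside-separated ux<r u∼L)
                                                                                              (outside-separated uy<r u∼L)) ⟩
    ∣ bump u x - bump u y ∣ + 0ℚ            ≡⟨ +-identityʳ _ ⟩
    ∣ bump u x - bump u y ∣                 ≤⟨ bump-lipschitz u x y ⟩
    w x y                                   ∎
    where open ≤-Reasoning
  ... | yes ux<r | no uy≮r = subst (_≤ w x y) (cong (_+ charge L x y) (sym (exit-charge ux<r (≮⇒≥ uy≮r))))
                               (depth+charge≤w L ux<r (≮⇒≥ uy≮r) u∼L L∼L)
  ... | no ux≮r | yes uy<r = subst₂ _≤_
                               (trans (cong (_+ charge L y x) (sym (exit-charge uy<r (≮⇒≥ ux≮r))))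
                                      (charge-sym (u ∷ L) y x))
                               (w-sym y x)
                               (depth+charge≤w L uy<r (≮⇒≥ ux≮r) u∼L L∼L)
  ... | no ux≮r | no uy≮r = begin
    ∣ bump u x - bump u y ∣ + charge L x y ≡⟨ cong (_+ charge L x y) (no-charge (≮⇒≥ ux≮r) (≮⇒≥ uy≮r)) ⟩
    0ℚ + charge L x y                       ≡⟨ +-identityˡ _ ⟩
    charge L x y                            ≤⟨ charge≤distance L∼L x y ⟩
    w x y                                   ∎
    where open ≤-Reasoning

  packing-bound : 0ℚ ≤ r → ∀ (E : List (Edge n)) (L : List (Fin n)) →
                  AllPairs Separated L →
                  All (λ u → ∃[ m ] (r ≤ w u m × Walk E m u)) L →
                  ∑[ _ ∈ L ] r ≤ ∑[ e ∈ E ] w (proj₁ e) (proj₂ e)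
  packing-bound 0≤r E L L∼L mates = begin
    ∑[ _ ∈ L ] r                            ≤⟨ ∑-mono-≤ L (All.map bump-drop mates) ⟩
    ∑[ u ∈ L ] variation (bump u) E         ≡⟨ ∑-comm L E (λ u e → ∣ bump u (proj₁ e) - bump u (proj₂ e) ∣) ⟩
    ∑[ e ∈ E ] charge L (proj₁ e) (proj₂ e) ≤⟨ ∑-mono-≤ E (All.universal (λ e → charge≤distance L∼L (proj₁ e) (proj₂ e)) E) ⟩
    ∑[ e ∈ E ] w (proj₁ e) (proj₂ e)        ∎
    where
    open ≤-Reasoning
    bump-drop : ∀ {u} → ∃[ m ] (r ≤ w u m × Walk E m u) → r ≤ variation (bump u) E
    bump-drop {u} (m , r≤um , m⇝u) = subst (_≤ variation (bump u) E) drop (rise≤variation E (bump u) m⇝u)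
      where
      drop : bump u u - bump u m ≡ r
      drop rewrite bump-centre 0≤r u | bump-outside r≤um = +-identityʳ r

elements : Subset n → List (Fin n)
elements []            = []
elements (inside ∷ p)  = zero ∷ map suc (elements p)
elements (outside ∷ p) = map suc (elements p)

length-elements : ∀ (p : Subset n) → length (elements p) ≡ ∣ p ∣ₛ
length-elements []            = refl
length-elements (inside ∷ p)  = cong ℕ.suc (trans (length-map suc (elements p)) (length-elements p))
length-elements (outside ∷ p) = trans (length-map suc (elements p)) (length-elements p)

elements-∈ : ∀ (p : Subset n) → All (_∈ₛ p) (elements p)
elements-∈ []            = []
elements-∈ (inside ∷ p)  = here ∷ All.map⁺ (All.map there (elements-∈ p))
elements-∈ (outside ∷ p) = All.map⁺ (All.map there (elements-∈ p))

elements-pairwise : ∀ {R : Fin n → Fin n → Set} (p : Subset n) →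
                    (∀ {u v} → u ∈ₛ p → v ∈ₛ p → u ≢ v → R u v) → AllPairs R (elements p)
elements-pairwise []      R-p = []
elements-pairwise (b ∷ p) R-p with elements-pairwise p (λ u∈p v∈p u≢v → R-p (there u∈p) (there v∈p) (u≢v ∘ suc-injective))
elements-pairwise (inside  ∷ p) R-p | pairwise =
  All.map⁺ (All.map (λ v∈p → R-p here (there v∈p) λ ()) (elements-∈ p)) ∷ AllPairs.map⁺ pairwise
elements-pairwise (outside ∷ p) R-p | pairwise = AllPairs.map⁺ pairwise

edges : EdgeSet n → List (Edge n)
edges {n} F = filterᵇ (uncurry F) (cartesianProduct (allFin n) (allFin n))

∈-edges : ∀ {F : EdgeSet n} {x y} → F x y ≡ true → (x , y) ∈ edges F
∈-edges {x = x} {y} Fxy = ∈-filter⁺ _ (∈-cartesianProduct⁺ (∈-allFin x) (∈-allFin y)) (Equivalence.from T-≡ Fxy)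

Connected⇒Walk : ∀ {F : EdgeSet n} {a b} → Connected F a b → Walk (edges F) a b
Connected⇒Walk here                   = ε
Connected⇒Walk (step (inj₁ Fxy) a⇝b) = inj₁ (∈-edges Fxy) ◅ Connected⇒Walk a⇝b
Connected⇒Walk (step (inj₂ Fyx) a⇝b) = inj₂ (∈-edges Fyx) ◅ Connected⇒Walk a⇝b

sumFin-cong : ∀ {n} {f g : Fin n → ℚ} → (∀ x → f x ≡ g x) → sumFin f ≡ sumFin g
sumFin-cong {n = ℕ.zero}  f≗g = refl
sumFin-cong {n = ℕ.suc n} f≗g = cong₂ _+_ (f≗g zero) (sumFin-cong (f≗g ∘ suc))

-- `cost` weighs edges by a function local to its definition; on a one-vertex graph it unfolds to
-- that weight plus two zeros, which identifies the weight with `if_then_else_`.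
cost-on-a-vertex : ∀ b q → cost {1} (λ _ _ → q) (λ _ _ → b) ≡ ((if b then q else 0ℚ) + 0ℚ) + 0ℚ
cost-on-a-vertex true  q = refl
cost-on-a-vertex false q = refl

cost-by-cases : ∀ (w : Fin n → Fin n → ℚ) F → cost w F ≡ sumFin (λ x → sumFin (λ y → if F x y then w x y else 0ℚ))
cost-by-cases w F = sumFin-cong (λ x → sumFin-cong (λ y → drop-zeros (cost-on-a-vertex (F x y) (w x y))))
  where
  drop-zeros : ∀ {p q} → (p + 0ℚ) + 0ℚ ≡ (q + 0ℚ) + 0ℚ → p ≡ q
  drop-zeros {p} {q} eq = begin
    p                 ≡⟨ trans (+-identityʳ _) (+-identityʳ p) ⟨
    (p + 0ℚ) + 0ℚ     ≡⟨ eq ⟩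
    (q + 0ℚ) + 0ℚ     ≡⟨ trans (+-identityʳ _) (+-identityʳ q) ⟩
    q                 ∎
    where open ≡-Reasoning

cost≡∑-edges : ∀ (w : Fin n → Fin n → ℚ) F → cost w F ≡ ∑[ e ∈ edges F ] w (proj₁ e) (proj₂ e)
cost≡∑-edges {n} w F = begin
  cost w F
    ≡⟨ cost-by-cases w F ⟩
  sumFin (λ x → sumFin (λ y → weight (x , y)))
    ≡⟨ ∑-tabulate (λ x → x) (λ x → sumFin (λ y → weight (x , y))) ⟨
  ∑[ x ∈ allFin n ] sumFin (λ y → weight (x , y))
    ≡⟨ ∑-cong (allFin n) (λ x → ∑-tabulate (λ y → y) (λ y → weight (x , y))) ⟨
  ∑[ x ∈ allFin n ] ∑[ y ∈ allFin n ] weight (x , y)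
    ≡⟨ ∑-cartesianProduct (allFin n) (allFin n) weight ⟨
  sumOver (cartesianProduct (allFin n) (allFin n)) weight
    ≡⟨ ∑-filterᵇ (uncurry F) (cartesianProduct (allFin n) (allFin n)) (uncurry w) ⟨
  ∑[ e ∈ edges F ] w (proj₁ e) (proj₂ e)
    ∎
  where
  open ≡-Reasoning
  weight : Edge n → ℚ
  weight e = if uncurry F e then uncurry w e else 0ℚ

ℕ→ℚ≡mkℚ : ∀ m → ℕ→ℚ m ≡ mkℚ (ℤ.+ m) 0 (Coprime.sym (1-coprimeTo m))
ℕ→ℚ≡mkℚ m = normalize-coprime (Coprime.sym (1-coprimeTo m))

ℕ→ℚ-+ : ∀ a b → ℕ→ℚ (a ℕ.+ b) ≡ ℕ→ℚ a + ℕ→ℚ b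
ℕ→ℚ-+ a b rewrite ℕ→ℚ≡mkℚ a | ℕ→ℚ≡mkℚ b =
  cong (ℚ._/ 1) (sym (cong₂ ℤ._+_ (ℤₚ.*-identityʳ (ℤ.+ a)) (ℤₚ.*-identityʳ (ℤ.+ b))))

ℕ→ℚ-nonNeg : ∀ m → 0ℚ ≤ ℕ→ℚ m
ℕ→ℚ-nonNeg m rewrite ℕ→ℚ≡mkℚ m = nonNegative⁻¹ _

ℕ→ℚ-double : ∀ m → ℕ→ℚ (2 * m) ≡ ℕ→ℚ m + ℕ→ℚ m
ℕ→ℚ-double m = trans (cong ℕ→ℚ (cong (m ℕ.+_) (ℕₚ.+-identityʳ m))) (ℕ→ℚ-+ m m)

∑-const : ∀ (xs : List A) k → ∑[ _ ∈ xs ] ℕ→ℚ k ≡ ℕ→ℚ (length xs * k)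
∑-const []       k = refl
∑-const (x ∷ xs) k = trans (cong (ℕ→ℚ k +_) (∑-const xs k)) (sym (ℕ→ℚ-+ k (length xs * k)))

independent⇒separated : ∀ {w : Fin n → Fin n → ℚ} i {u v} → u ≢ v → ¬ Adj w i u v →
                        ℕ→ℚ (τ i) + ℕ→ℚ (τ i) ≤ w u v
independent⇒separated i u≢v ¬adj = subst (_≤ _) (ℕ→ℚ-double (τ i)) (≮⇒≥ (λ w<2τ → ¬adj (u≢v , w<2τ)))

active⇒mate : ∀ {k} {w : Fin n → Fin n → ℚ} {s t : Fin k → Fin n} {F} → IsMetric w → Feasible s t F →
              ∀ {i u} → Active w s t i u → ∃[ m ] (ℕ→ℚ (τ i) ≤ w u m × Walk (edges F) m u)
active⇒mate {t = t} _ feasible (j , inj₁ refl , τ≤w) = t j , τ≤w , reverse swap (Connected⇒Walk (feasible j))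
active⇒mate {s = s} {t} metric feasible (j , inj₂ refl , τ≤w) =
  s j , subst (_ ≤_) (IsMetric.w-sym metric (s j) (t j)) τ≤w , Connected⇒Walk (feasible j)

lemma2p1 : ∀ {n k : ℕ} (w : Fin n → Fin n → ℚ) (s t : Fin k → Fin n)
  → IsMetric w → DisjointPairs s t
  → (opt : ℚ) → IsOPT w s t opt
  → (i : ℕ) → i ℕ.≤ Lk k
  → (I : Subset n) → MaximalIndependentH w s t i I
  → ℕ→ℚ (∣ I ∣ₛ * τ i) ≤ opt
lemma2p1 w s t metric _ opt ((F , feasible , cost≡opt) , _) i _ I ((active , independent) , _) = begin
  ℕ→ℚ (∣ I ∣ₛ * τ i)                      ≡⟨ cong (λ m → ℕ→ℚ (m * τ i)) (length-elements I) ⟨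
  ℕ→ℚ (length (elements I) * τ i)          ≡⟨ ∑-const (elements I) (τ i) ⟨
  ∑[ _ ∈ elements I ] ℕ→ℚ (τ i)            ≤⟨ packing-bound (ℕ→ℚ-nonNeg (τ i)) (edges F) (elements I) separated mates ⟩
  ∑[ e ∈ edges F ] w (proj₁ e) (proj₂ e)   ≡⟨ cost≡∑-edges w F ⟨
  cost w F                                 ≡⟨ cost≡opt ⟩
  opt                                      ∎
  where
  open ≤-Reasoning
  open Packing metric (ℕ→ℚ (τ i))
  separated : AllPairs Separated (elements I)
  separated = elements-pairwise I (λ u∈I v∈I u≢v → independent⇒separated {w = w} i u≢v (independent _ _ u∈I v∈I))
  mates : All (λ u → ∃[ m ] (ℕ→ℚ (τ i) ≤ w u m × Walk (edges F) m u)) (elements I)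
  mates = All.map (λ u∈I → active⇒mate metric feasible {i} (active _ u∈I)) (elements-∈ I)
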